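{- For each integer $a\geqslant 2$, $$\delta([a])=2\sum_{b=3}^{a}(b,\underbrace{1,\ldots,1}_{a-b})+3\,(2,\underbrace{1,\ldots,1}_{a-2}).$$
   Context: A composition is a finite sequence $\mathbf{a}=(a_1,\ldots,a_r)$ of positive integers ($r\geqslant0$), of weight $\sum a_i$; admissible if $r=0$ or $a_1\geqslant2$. $\mathcal{A}$ (resp. $\mathcal{A}_k$) is the set of admissible compositions (resp. of weight $k$). Binary word $\mathbf{w}(\mathbf{a})=0^{a_1-1}1\cdots0^{a_r-1}1$; the dual of a word $\varepsilon_1\cdots\varepsilon_k$ is $\overline{\varepsilon_k}\cdots\overline{\varepsilon_1}$ ($\overline0=1,\overline1=0$); $\overline{\mathbf{a}}$ is the admissible composition with word dual to $\mathbf{w}(\mathbf{a})$. $\mathcal{B}=\mathcal{A}/(\mathbf{a}\sim\overline{\mathbf{a}})$, classes $[\mathbf{a}]$, $\mathcal{B}_k$ classes of weight $k$; $\mathbf{Z}^{(X)}$ is the free $\mathbf{Z}$-module on $X$; $(a)$ denotes the composition of depth one with entry $a$. $(a_1,\ldots,a_r)^{\rm init}=(a_1,\ldots,a_{r-1})$ ($\varnothing^{\rm init}=\varnothing$); for admissible $\mathbf{a}$, $\mathbf{a}^{\rm fin}$ is the dual of $(\overline{\mathbf{a}})^{\rm init}$, $\mathbf{a}^{\rm mid}=(\mathbf{a}^{\rm fin})^{\rm init}$; extended $\mathbf{Z}$-linearly. $\delta$ is the unique $\mathbf{Z}$-linear map $\mathbf{Z}^{(\mathcal{B})}\to\mathbf{Z}^{(\mathcal{A})}$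 with $\delta(\mathbf{Z}^{\mathcal{B}_k})\subset\mathbf{Z}^{\mathcal{A}_k}$ for all $k$, $\delta([\varnothing])=\varnothing$, and $\delta([\mathbf{a}])^{\rm init}=\delta([\mathbf{a}^{\rm init}])+\delta([\mathbf{a}^{\rm mid}])+\delta([\mathbf{a}^{\rm fin}])$ for all non-empty admissible $\mathbf{a}$. -}

module Defs where

open import Data.Nat as ℕ using (ℕ; zero; suc; _≤_; _∸_)
open import Data.Integer as ℤ using (ℤ; +_)
open import Data.Bool using (Bool; true; false; not)
open import Data.List using (List; []; _∷_; _++_; map; reverse; replicate; upTo; foldr)
open import Data.Nat.ListAction using (sum)
open import Data.List.Relation.Unary.All using (All)
open import Data.List.Properties using (≡-dec)
open import Data.Product using (_×_; _,_)
open import Relation.Nullary using (¬_; yes; no)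
open import Relation.Binary.PropositionalEquality using (_≡_)

Composition : Set
Composition = List ℕ

IsComposition : Composition → Set
IsComposition = All (λ n → 1 ≤ n)

data Admissible : Composition → Set where
  adm-nil  : Admissible []
  adm-cons : ∀ {a as} → 2 ≤ a → IsComposition as → Admissible (a ∷ as)

weight : Composition → ℕ
weight = sum

-- binary word 0^{a1-1} 1 ... 0^{ar-1} 1   (false = 0, true = 1)
toWord : Composition → List Bool
toWord [] = []
toWord (a ∷ as) = replicate (a ∸ 1) false ++ (true ∷ toWord as)

fromWord′ : ℕ → List Bool → Composition
fromWord′ n [] = []
fromWord′ n (true ∷ w) = suc n ∷ fromWord′ 0 w
fromWord′ n (false ∷ w) = fromWord′ (suc n) w

fromWord : List Bool → Composition
fromWord = fromWord′ 0

dualWord : List Bool → List Bool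
dualWord w = reverse (map not w)

dual : Composition → Composition
dual a = fromWord (dualWord (toWord a))

init : Composition → Composition
init [] = []
init (x ∷ []) = []
init (x ∷ y ∷ xs) = x ∷ init (y ∷ xs)

fin : Composition → Composition
fin a = dual (init (dual a))

mid : Composition → Composition
mid a = init (fin a)

-- Elements of Z^(A): formal finite Z-linear combinations, as lists of terms,
-- compared coefficientwise.
FormalSum : Set
FormalSum = List (ℤ × Composition)

coeff : FormalSum → Composition → ℤ
coeff [] c = + 0
coeff ((z , d) ∷ xs) c with ≡-dec ℕ._≟_ d c
... | yes _ = z ℤ.+ coeff xs c
... | no _ = coeff xs c

_≈_ : FormalSum → FormalSum → Set
x ≈ y = ∀ c → coeff x c ≡ coeff y c

infix 4 _≈_

basis : Composition → FormalSum
basis c = (+ 1 , c) ∷ []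

initLin : FormalSum → FormalSum
initLin = map (λ { (z , d) → (z , init d) })

-- δ : Z^(B) → Z^(A) is given by its values on basis classes [a]; we model it as a
-- function on compositions which is constant on duality classes of admissible ones.
record IsDelta (δ : Composition → FormalSum) : Set where
  field
    classInvariant : ∀ a → Admissible a → δ a ≈ δ (dual a)
    homogeneous    : ∀ a → Admissible a → ∀ c → ¬ (coeff (δ a) c ≡ + 0) →
                       Admissible c × weight c ≡ weight a
    empty          : δ [] ≈ basis []
    recursion      : ∀ x xs → Admissible (x ∷ xs) →
                       initLin (δ (x ∷ xs)) ≈
                         δ (init (x ∷ xs)) ++ δ (mid (x ∷ xs)) ++ δ (fin (x ∷ xs))

rhs12 : ℕ → FormalSum
rhs12 a = map (λ b → (+ 2 , b ∷ replicate (a ∸ b) 1)) (map (λ i → 3 ℕ.+ i) (upTo (a ∸ 2)))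
          ++ ((+ 3 , 2 ∷ replicate (a ∸ 2) 1) ∷ [])

-- Both sides are homogeneous of weight a, and on compositions of a fixed positive weight
-- c ↦ c^init is injective (c is recovered by appending the missing weight); as the linear
-- extension of any map respects coefficientwise equality, it suffices to compare the images
-- under init. For one-entry compositions (a)^init = ∅, (2)^fin = ∅ and (a+1)^fin = (a), so
-- the recursion reads δ((2))^init = 3∅ and δ((a+1))^init = 2∅ + δ((a)); the right-hand side
-- satisfies the same two relations, and induction on a concludes.
module Submission where

open import Defs
open import Data.Nat using (ℕ; _≤_)
open import Data.List using ([]; _∷_)

open import Data.Nat as ℕ using (zero; suc; _+_; _∸_; z≤n; s≤s)
import Data.Nat.Properties as ℕₚ
open import Data.Integer as ℤ using (ℤ; +_)
import Data.Integer.Properties as ℤₚ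
open import Algebra.Properties.CommutativeSemigroup ℤₚ.+-commutativeSemigroup
  using (x∙yz≈y∙xz)
open import Data.Bool using (true; false; not)
open import Data.Empty using (⊥-elim)
open import Data.List using (List; _++_; map; reverse; replicate; upTo; filter; length; _∷ʳ_)
import Data.List.Properties as Listₚ
open import Data.List.Relation.Unary.All as All using (All; []; _∷_)
import Data.List.Relation.Unary.All.Properties as Allₚ
open import Data.List.Properties using (≡-dec)
open import Data.Product using (_×_; _,_; proj₂; map₂)
open import Function using (_∘_)
open import Level using (0ℓ)
open import Relation.Nullary using (¬_; yes; no; ¬?)
open import Relation.Unary using (Pred; Decidable)
open import Relation.Binary using (Setoid; DecidableEquality)
import Relation.Binary.Reasoning.Setoid
open import Relation.Binary.PropositionalEquality
  using (_≡_; _≢_; refl; sym; trans; cong; cong₂; subst; module ≡-Reasoning)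

_≟ᶜ_ : DecidableEquality Composition
_≟ᶜ_ = ≡-dec ℕ._≟_

coeff-∷-≡ : ∀ {z e X c} → e ≡ c → coeff ((z , e) ∷ X) c ≡ z ℤ.+ coeff X c
coeff-∷-≡ {e = e} {c = c} e≡c with e ≟ᶜ c
... | yes _  = refl
... | no e≢c = ⊥-elim (e≢c e≡c)

coeff-∷-≢ : ∀ {z e X c} → e ≢ c → coeff ((z , e) ∷ X) c ≡ coeff X c
coeff-∷-≢ {e = e} {c = c} e≢c with e ≟ᶜ c
... | yes e≡c = ⊥-elim (e≢c e≡c)
... | no _    = refl

coeff-∷ : ∀ z e X c → coeff ((z , e) ∷ X) c ≡ coeff ((z , e) ∷ []) c ℤ.+ coeff X c
coeff-∷ z e X c with e ≟ᶜ c
... | yes _ = cong (ℤ._+ coeff X c) (sym (ℤₚ.+-identityʳ z))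
... | no _  = sym (ℤₚ.+-identityˡ (coeff X c))

coeff-++ : ∀ X Y c → coeff (X ++ Y) c ≡ coeff X c ℤ.+ coeff Y c
coeff-++ []            Y c = sym (ℤₚ.+-identityˡ (coeff Y c))
coeff-++ ((z , e) ∷ X) Y c = begin
  coeff ((z , e) ∷ X ++ Y) c         ≡⟨ coeff-∷ z e (X ++ Y) c ⟩
  a ℤ.+ coeff (X ++ Y) c             ≡⟨ cong (λ t → a ℤ.+ t) (coeff-++ X Y c) ⟩
  a ℤ.+ (coeff X c ℤ.+ coeff Y c)    ≡⟨ ℤₚ.+-assoc a (coeff X c) (coeff Y c) ⟨
  (a ℤ.+ coeff X c) ℤ.+ coeff Y c    ≡⟨ cong (ℤ._+ coeff Y c) (coeff-∷ z e X c) ⟨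
  coeff ((z , e) ∷ X) c ℤ.+ coeff Y c ∎
  where
  open ≡-Reasoning
  a = coeff ((z , e) ∷ []) c

coeff-∷-cong : ∀ t {X Y c} → coeff X c ≡ coeff Y c → coeff (t ∷ X) c ≡ coeff (t ∷ Y) c
coeff-∷-cong (z , e) {X} {Y} {c} eq =
  trans (coeff-∷ z e X c)
        (trans (cong (λ t → coeff ((z , e) ∷ []) c ℤ.+ t) eq) (sym (coeff-∷ z e Y c)))

≈-setoid : Setoid 0ℓ 0ℓ
≈-setoid = record
  { Carrier       = FormalSum
  ; _≈_           = _≈_
  ; isEquivalence = record
    { refl  = λ _ → refl
    ; sym   = λ eq c → sym (eq c)
    ; trans = λ eq eq′ c → trans (eq c) (eq′ c)
    }
  }

open Setoid ≈-setoid using () renaming (sym to ≈-sym)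
module ≈-Reasoning = Relation.Binary.Reasoning.Setoid ≈-setoid

∷-cong : ∀ t {X Y} → X ≈ Y → t ∷ X ≈ t ∷ Y
∷-cong t eq c = coeff-∷-cong t (eq c)

++-cong : ∀ {X X′ Y Y′} → X ≈ X′ → Y ≈ Y′ → X ++ Y ≈ X′ ++ Y′
++-cong {X} {X′} {Y} {Y′} eqX eqY c =
  trans (coeff-++ X Y c) (trans (cong₂ ℤ._+_ (eqX c) (eqY c)) (sym (coeff-++ X′ Y′ c)))

∷-swap : ∀ s t X → s ∷ t ∷ X ≈ t ∷ s ∷ X
∷-swap (z , e) (z′ , e′) X c = begin
  coeff ((z , e) ∷ (z′ , e′) ∷ X) c   ≡⟨ coeff-∷ z e _ c ⟩
  a ℤ.+ coeff ((z′ , e′) ∷ X) c       ≡⟨ cong (λ t → a ℤ.+ t) (coeff-∷ z′ e′ X c) ⟩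
  a ℤ.+ (a′ ℤ.+ coeff X c)            ≡⟨ x∙yz≈y∙xz a a′ (coeff X c) ⟩
  a′ ℤ.+ (a ℤ.+ coeff X c)            ≡⟨ cong (λ t → a′ ℤ.+ t) (sym (coeff-∷ z e X c)) ⟩
  a′ ℤ.+ coeff ((z , e) ∷ X) c        ≡⟨ sym (coeff-∷ z′ e′ _ c) ⟩
  coeff ((z′ , e′) ∷ (z , e) ∷ X) c   ∎
  where
  open ≡-Reasoning
  a  = coeff ((z , e) ∷ []) c
  a′ = coeff ((z′ , e′) ∷ []) c

coeff-single-+ : ∀ z z′ e c →
  coeff ((z , e) ∷ []) c ℤ.+ coeff ((z′ , e) ∷ []) c ≡ coeff ((z ℤ.+ z′ , e) ∷ []) c
coeff-single-+ z z′ e c with e ≟ᶜ c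
... | yes _ = begin
  (z ℤ.+ + 0) ℤ.+ (z′ ℤ.+ + 0)   ≡⟨ cong₂ ℤ._+_ (ℤₚ.+-identityʳ z) (ℤₚ.+-identityʳ z′) ⟩
  z ℤ.+ z′                       ≡⟨ sym (ℤₚ.+-identityʳ (z ℤ.+ z′)) ⟩
  (z ℤ.+ z′) ℤ.+ + 0             ∎
  where open ≡-Reasoning
... | no _  = refl

∷-merge : ∀ z z′ e X → (z , e) ∷ (z′ , e) ∷ X ≈ (z ℤ.+ z′ , e) ∷ X
∷-merge z z′ e X c = begin
  coeff ((z , e) ∷ (z′ , e) ∷ X) c   ≡⟨ coeff-∷ z e _ c ⟩
  a ℤ.+ coeff ((z′ , e) ∷ X) c       ≡⟨ cong (λ t → a ℤ.+ t) (coeff-∷ z′ e X c) ⟩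
  a ℤ.+ (a′ ℤ.+ coeff X c)           ≡⟨ sym (ℤₚ.+-assoc a a′ (coeff X c)) ⟩
  (a ℤ.+ a′) ℤ.+ coeff X c           ≡⟨ cong (ℤ._+ coeff X c) (coeff-single-+ z z′ e c) ⟩
  coeff ((z ℤ.+ z′ , e) ∷ []) c ℤ.+ coeff X c ≡⟨ sym (coeff-∷ (z ℤ.+ z′) e X c) ⟩
  coeff ((z ℤ.+ z′ , e) ∷ X) c       ∎
  where
  open ≡-Reasoning
  a  = coeff ((z , e) ∷ []) c
  a′ = coeff ((z′ , e) ∷ []) c

++-∷ : ∀ X t Y → X ++ t ∷ Y ≈ t ∷ X ++ Y
++-∷ []      t Y = λ _ → refl
++-∷ (s ∷ X) t Y = begin
  s ∷ X ++ t ∷ Y   ≈⟨ ∷-cong s (++-∷ X t Y) ⟩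
  s ∷ t ∷ X ++ Y   ≈⟨ ∷-swap s t (X ++ Y) ⟩
  t ∷ s ∷ X ++ Y   ∎
  where open ≈-Reasoning

restrict : {P : Pred Composition 0ℓ} → Decidable P → FormalSum → FormalSum
restrict P? = filter (P? ∘ proj₂)

module _ {P : Pred Composition 0ℓ} (P? : Decidable P) where

  coeff-restrict-accept : ∀ {c} → P c → ∀ X → coeff (restrict P? X) c ≡ coeff X c
  coeff-restrict-accept Pc [] = refl
  coeff-restrict-accept Pc ((z , e) ∷ X) with P? e
  ... | yes _  = coeff-∷-cong (z , e) (coeff-restrict-accept Pc X)
  ... | no ¬Pe = trans (coeff-restrict-accept Pc X)
                       (sym (coeff-∷-≢ λ e≡c → ¬Pe (subst P (sym e≡c) Pc)))

  coeff-restrict-reject : ∀ {c} → ¬ P c → ∀ X → coeff (restrict P? X) c ≡ + 0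
  coeff-restrict-reject ¬Pc [] = refl
  coeff-restrict-reject ¬Pc ((z , e) ∷ X) with P? e
  ... | yes Pe = trans (coeff-∷-≢ λ e≡c → ¬Pc (subst P e≡c Pe)) (coeff-restrict-reject ¬Pc X)
  ... | no _   = coeff-restrict-reject ¬Pc X

  restrict-cong : ∀ {X Y} → X ≈ Y → restrict P? X ≈ restrict P? Y
  restrict-cong {X} {Y} eq c with P? c
  ... | yes Pc = trans (coeff-restrict-accept Pc X) (trans (eq c) (sym (coeff-restrict-accept Pc Y)))
  ... | no ¬Pc = trans (coeff-restrict-reject ¬Pc X) (sym (coeff-restrict-reject ¬Pc Y))

remove : Composition → FormalSum → FormalSum
remove c₀ = restrict (λ c → ¬? (c₀ ≟ᶜ c))

remove-cong : ∀ c₀ X Y → X ≈ Y → remove c₀ X ≈ remove c₀ Y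
remove-cong c₀ X Y = restrict-cong (λ c → ¬? (c₀ ≟ᶜ c)) {X} {Y}

relabel : (Composition → Composition) → FormalSum → FormalSum
relabel f = map (map₂ f)

relabel-collect : ∀ f c₀ X → relabel f X ≈ (coeff X c₀ , f c₀) ∷ relabel f (remove c₀ X)
relabel-collect f c₀ [] c with f c₀ ≟ᶜ c
... | yes _ = refl
... | no _  = refl
relabel-collect f c₀ ((z , e) ∷ X) with c₀ ≟ᶜ e
... | yes refl = begin
  (z , f c₀) ∷ relabel f X
    ≈⟨ ∷-cong (z , f c₀) (relabel-collect f c₀ X) ⟩
  (z , f c₀) ∷ (coeff X c₀ , f c₀) ∷ R
    ≈⟨ ∷-merge z _ (f c₀) R ⟩
  (z ℤ.+ coeff X c₀ , f c₀) ∷ R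
    ≡⟨ cong (λ w → (w , f c₀) ∷ R) (sym (coeff-∷-≡ {z} {c₀} {X} refl)) ⟩
  (coeff ((z , c₀) ∷ X) c₀ , f c₀) ∷ R
    ∎
  where
  open ≈-Reasoning
  R = relabel f (remove c₀ X)
... | no c₀≢e = begin
  (z , f e) ∷ relabel f X
    ≈⟨ ∷-cong (z , f e) (relabel-collect f c₀ X) ⟩
  (z , f e) ∷ (coeff X c₀ , f c₀) ∷ R
    ≈⟨ ∷-swap (z , f e) (coeff X c₀ , f c₀) R ⟩
  (coeff X c₀ , f c₀) ∷ (z , f e) ∷ R
    ≡⟨ cong (λ w → (w , f c₀) ∷ (z , f e) ∷ R) (sym (coeff-∷-≢ (c₀≢e ∘ sym))) ⟩
  (coeff ((z , e) ∷ X) c₀ , f c₀) ∷ (z , f e) ∷ R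
    ∎
  where
  open ≈-Reasoning
  R = relabel f (remove c₀ X)

module _ (f : Composition → Composition) where

  private
    relabel-cong-through : ∀ c₀ X Y → X ≈ Y →
      relabel f (remove c₀ X) ≈ relabel f (remove c₀ Y) → relabel f X ≈ relabel f Y
    relabel-cong-through c₀ X Y eq eq₀ = begin
      relabel f X
        ≈⟨ relabel-collect f c₀ X ⟩
      (coeff X c₀ , f c₀) ∷ relabel f (remove c₀ X)
        ≡⟨ cong (λ w → (w , f c₀) ∷ _) (eq c₀) ⟩
      (coeff Y c₀ , f c₀) ∷ relabel f (remove c₀ X)
        ≈⟨ ∷-cong (coeff Y c₀ , f c₀) eq₀ ⟩
      (coeff Y c₀ , f c₀) ∷ relabel f (remove c₀ Y)
        ≈⟨ relabel-collect f c₀ Y ⟨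
      relabel f Y
        ∎
      where open ≈-Reasoning

    length-remove-∷ : ∀ z c₀ X → length (remove c₀ ((z , c₀) ∷ X)) ≤ length X
    length-remove-∷ z c₀ X with c₀ ≟ᶜ c₀
    ... | yes _     = Listₚ.length-filter _ X
    ... | no c₀≢c₀ = ⊥-elim (c₀≢c₀ refl)

    -- The fuel bounds length X + length Y, which drops when a label is removed from both sides.
    relabel-cong′ : ∀ n X Y → length X + length Y ≤ n → X ≈ Y → relabel f X ≈ relabel f Y
    relabel-cong′ _ [] [] _ _ = λ _ → refl
    relabel-cong′ (suc n) ((z , c₀) ∷ X) Y (s≤s l) eq =
      relabel-cong-through c₀ ((z , c₀) ∷ X) Y eq
        (relabel-cong′ n (remove c₀ ((z , c₀) ∷ X)) (remove c₀ Y) bound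
                                  (remove-cong c₀ ((z , c₀) ∷ X) Y eq))
      where
      bound : length (remove c₀ ((z , c₀) ∷ X)) + length (remove c₀ Y) ≤ n
      bound = ℕₚ.≤-trans (ℕₚ.+-mono-≤ (length-remove-∷ z c₀ X) (Listₚ.length-filter _ Y)) l
    relabel-cong′ (suc n) [] ((z , c₀) ∷ Y) (s≤s l) eq =
      relabel-cong-through c₀ [] ((z , c₀) ∷ Y) eq
        (relabel-cong′ n [] (remove c₀ ((z , c₀) ∷ Y)) bound
                                  (remove-cong c₀ [] ((z , c₀) ∷ Y) eq))
      where
      bound : length (remove c₀ ((z , c₀) ∷ Y)) ≤ n
      bound = ℕₚ.≤-trans (length-remove-∷ z c₀ Y) l

  relabel-cong : ∀ {X Y} → X ≈ Y → relabel f X ≈ relabel f Y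
  relabel-cong {X} {Y} = relabel-cong′ (length X + length Y) X Y ℕₚ.≤-refl

  relabel-restrict-fixed : {P : Pred Composition 0ℓ} (P? : Decidable P) →
    (∀ {c} → P c → f c ≡ c) → ∀ X → relabel f (restrict P? X) ≡ restrict P? X
  relabel-restrict-fixed P? fixed [] = refl
  relabel-restrict-fixed P? fixed ((z , e) ∷ X) with P? e
  ... | yes Pe = cong₂ (λ d Y → (z , d) ∷ Y) (fixed Pe) (relabel-restrict-fixed P? fixed X)
  ... | no _   = relabel-restrict-fixed P? fixed X

-- Homogeneity and init

Homogeneous : ℕ → FormalSum → Set
Homogeneous w X = ∀ c → weight c ≢ w → coeff X c ≡ + 0

hasWeight? : ∀ w → Decidable (λ c → weight c ≡ w)
hasWeight? w c = weight c ℕ.≟ w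

homogeneous-restrict : ∀ {w} X → Homogeneous w X → restrict (hasWeight? w) X ≈ X
homogeneous-restrict {w} X hom c with weight c ℕ.≟ w
... | yes wc = coeff-restrict-accept _ wc X
... | no ¬wc = trans (coeff-restrict-reject _ ¬wc X) (sym (hom c ¬wc))

homogeneous-All : ∀ {w X} → All (λ t → weight (proj₂ t) ≡ w) X → Homogeneous w X
homogeneous-All []                       c ¬wc = refl
homogeneous-All {w} {(z , e) ∷ X} (we ∷ ws) c ¬wc =
  trans (coeff-∷-≢ {z} {e} {X} λ e≡c → ¬wc (subst (λ d → weight d ≡ w) e≡c we))
        (homogeneous-All ws c ¬wc)

extendTo : ℕ → Composition → Composition
extendTo w d = d ++ (w ∸ weight d) ∷ []

extendTo-init : ∀ c → c ≢ [] → extendTo (weight c) (init c) ≡ c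
extendTo-init []           c≢[] = ⊥-elim (c≢[] refl)
extendTo-init (x ∷ [])     _    = cong (_∷ []) (ℕₚ.+-identityʳ x)
extendTo-init (x ∷ y ∷ xs) _    = cong (x ∷_) (trans
  (cong (λ r → init (y ∷ xs) ++ r ∷ [])
        (ℕₚ.[m+n]∸[m+o]≡n∸o x (weight (y ∷ xs)) (weight (init (y ∷ xs)))))
  (extendTo-init (y ∷ xs) λ ()))

homogeneous-extendTo-initLin : ∀ {w} X → 1 ≤ w → Homogeneous w X →
  relabel (extendTo w) (initLin X) ≈ X
homogeneous-extendTo-initLin {w} X 1≤w hom = begin
  relabel (extendTo w) (initLin X)
    ≡⟨ sym (Listₚ.map-∘ X) ⟩
  relabel (extendTo w ∘ init) X
    ≈⟨ relabel-cong (extendTo w ∘ init) {X} {X′}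
                    (≈-sym {X′} {X} (homogeneous-restrict X hom)) ⟩
  relabel (extendTo w ∘ init) X′
    ≡⟨ relabel-restrict-fixed _ (hasWeight? w) fixed X ⟩
  X′
    ≈⟨ homogeneous-restrict X hom ⟩
  X
    ∎
  where
  open ≈-Reasoning
  X′ = restrict (hasWeight? w) X
  fixed : ∀ {c} → weight c ≡ w → extendTo w (init c) ≡ c
  fixed {[]}         0≡w = ⊥-elim (ℕₚ.<⇒≢ 1≤w 0≡w)
  fixed {c@(_ ∷ _)} wc  = subst (λ v → extendTo v (init c) ≡ c) wc (extendTo-init c λ ())

homogeneous-initLin-injective : ∀ {w} X Y → 1 ≤ w → Homogeneous w X → Homogeneous w Y →
  initLin X ≈ initLin Y → X ≈ Y
homogeneous-initLin-injective {w} X Y 1≤w homX homY eq = begin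
  X                                   ≈⟨ homogeneous-extendTo-initLin X 1≤w homX ⟨
  relabel (extendTo w) (initLin X)    ≈⟨ relabel-cong (extendTo w) {initLin X} {initLin Y} eq ⟩
  relabel (extendTo w) (initLin Y)    ≈⟨ homogeneous-extendTo-initLin Y 1≤w homY ⟩
  Y                                   ∎
  where open ≈-Reasoning

-- Duals of the compositions (a) and (2,1,…,1)

dualWord-++ : ∀ u v → dualWord (u ++ v) ≡ dualWord v ++ dualWord u
dualWord-++ u v = trans (cong reverse (Listₚ.map-++ not u v)) (Listₚ.reverse-++ (map not u) (map not v))

replicate-∷ʳ : ∀ {A : Set} k (x : A) → replicate k x ∷ʳ x ≡ x ∷ replicate k x
replicate-∷ʳ zero    x = refl
replicate-∷ʳ (suc k) x = cong (x ∷_) (replicate-∷ʳ k x)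

reverse-replicate : ∀ {A : Set} k (x : A) → reverse (replicate k x) ≡ replicate k x
reverse-replicate zero    x = refl
reverse-replicate (suc k) x = trans (Listₚ.unfold-reverse x (replicate k x))
  (trans (cong (_∷ʳ x) (reverse-replicate k x)) (replicate-∷ʳ k x))

dualWord-replicate : ∀ k b → dualWord (replicate k b) ≡ replicate k (not b)
dualWord-replicate k b = trans (cong reverse (Listₚ.map-replicate not k b)) (reverse-replicate k (not b))

fromWord′-falses : ∀ k n w → fromWord′ n (replicate k false ++ w) ≡ fromWord′ (k + n) w
fromWord′-falses zero    n w = refl
fromWord′-falses (suc k) n w =
  trans (fromWord′-falses k (suc n) w) (cong (λ m → fromWord′ m w) (ℕₚ.+-suc k n))

fromWord-trues : ∀ k → fromWord (replicate k true) ≡ replicate k 1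
fromWord-trues zero    = refl
fromWord-trues (suc k) = cong (1 ∷_) (fromWord-trues k)

toWord-ones : ∀ k → toWord (replicate k 1) ≡ replicate k true
toWord-ones zero    = refl
toWord-ones (suc k) = cong (true ∷_) (toWord-ones k)

init-replicate : ∀ x k y → init (x ∷ replicate (suc k) y) ≡ x ∷ replicate k y
init-replicate x zero    y = refl
init-replicate x (suc k) y = cong (x ∷_) (init-replicate y k y)

dual-single : ∀ k → dual (2 + k ∷ []) ≡ 2 ∷ replicate k 1
dual-single k = begin
  fromWord (dualWord (replicate (suc k) false ++ true ∷ []))
    ≡⟨ cong fromWord (dualWord-++ (replicate (suc k) false) _) ⟩
  fromWord (false ∷ dualWord (replicate (suc k) false))
    ≡⟨ cong (fromWord ∘ (false ∷_)) (dualWord-replicate (suc k) false) ⟩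
  2 ∷ fromWord (replicate k true)
    ≡⟨ cong (2 ∷_) (fromWord-trues k) ⟩
  2 ∷ replicate k 1
    ∎
  where open ≡-Reasoning

dual-two-ones : ∀ m → dual (2 ∷ replicate m 1) ≡ 2 + m ∷ []
dual-two-ones m = begin
  fromWord (dualWord (false ∷ true ∷ toWord (replicate m 1)))
    ≡⟨ cong (λ w → fromWord (dualWord (false ∷ true ∷ w))) (toWord-ones m) ⟩
  fromWord (dualWord ((false ∷ true ∷ []) ++ replicate m true))
    ≡⟨ cong fromWord (dualWord-++ (false ∷ true ∷ []) (replicate m true)) ⟩
  fromWord (dualWord (replicate m true) ++ false ∷ true ∷ [])
    ≡⟨ cong (λ w → fromWord (w ++ false ∷ true ∷ [])) (dualWord-replicate m true) ⟩
  fromWord (replicate m false ++ false ∷ true ∷ [])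
    ≡⟨ fromWord′-falses m 0 _ ⟩
  2 + (m + 0) ∷ []
    ≡⟨ cong (λ n → 2 + n ∷ []) (ℕₚ.+-identityʳ m) ⟩
  2 + m ∷ []
    ∎
  where open ≡-Reasoning

fin-single : ∀ m → fin (3 + m ∷ []) ≡ 2 + m ∷ []
fin-single m = begin
  dual (init (dual (3 + m ∷ [])))      ≡⟨ cong (dual ∘ init) (dual-single (suc m)) ⟩
  dual (init (2 ∷ replicate (suc m) 1)) ≡⟨ cong dual (init-replicate 2 m 1) ⟩
  dual (2 ∷ replicate m 1)             ≡⟨ dual-two-ones m ⟩
  2 + m ∷ []                           ∎
  where open ≡-Reasoning

hook : ℕ → ℕ → ℤ × Composition
hook a b = (+ 2 , b ∷ replicate (a ∸ b) 1)

weight-ones : ∀ k → weight (replicate k 1) ≡ k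
weight-ones zero    = refl
weight-ones (suc k) = cong suc (weight-ones k)

weight-hook : ∀ {a b} → b ≤ a → weight (proj₂ (hook a b)) ≡ a
weight-hook {a} {b} b≤a = trans (cong (b ℕ.+_) (weight-ones (a ∸ b))) (ℕₚ.m+[n∸m]≡n b≤a)

initLin-hooks : ∀ {a L} → All (_≤ a) L → initLin (map (hook (suc a)) L) ≡ map (hook a) L
initLin-hooks []                   = refl
initLin-hooks {a} {b ∷ L} (b≤a ∷ bs) = cong₂ _∷_
  (cong (λ r → (+ 2 , r)) (trans (cong (λ n → init (b ∷ replicate n 1)) (ℕₚ.+-∸-assoc 1 b≤a))
                                 (init-replicate b (a ∸ b) 1)))
  (initLin-hooks bs)

shifted-upTo : ℕ → List ℕ
shifted-upTo m = map (3 ℕ.+_) (upTo m)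

shifted-upTo-bounded : ∀ m → All (_≤ 2 + m) (shifted-upTo m)
shifted-upTo-bounded m = subst (All (_≤ 2 + m)) (sym (Listₚ.map-upTo (3 ℕ.+_) m))
  (Allₚ.applyUpTo⁺₁ (3 ℕ.+_) m λ i<m → s≤s (s≤s i<m))

shifted-upTo-∷ʳ : ∀ m → shifted-upTo (suc m) ≡ shifted-upTo m ∷ʳ (3 + m)
shifted-upTo-∷ʳ m =
  trans (cong (map (3 ℕ.+_)) (sym (Listₚ.upTo-∷ʳ m))) (Listₚ.map-++ (3 ℕ.+_) (upTo m) (m ∷ []))

rhs12-homogeneous : ∀ k → Homogeneous (2 + k) (rhs12 (2 + k))
rhs12-homogeneous k = homogeneous-All (Allₚ.++⁺
  (Allₚ.map⁺ (All.map weight-hook (shifted-upTo-bounded k)))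
  (cong (2 ℕ.+_) (weight-ones k) ∷ []))

initLin-rhs12 : ∀ m → initLin (rhs12 (3 + m)) ≡
  map (hook (2 + m)) (shifted-upTo m) ++ (+ 2 , []) ∷ (+ 3 , 2 ∷ replicate m 1) ∷ []
initLin-rhs12 m = begin
  initLin (map (hook a) (shifted-upTo (suc m)) ++ top)
    ≡⟨ cong (λ L′ → initLin (map (hook a) L′ ++ top)) (shifted-upTo-∷ʳ m) ⟩
  initLin (map (hook a) (L ++ a ∷ []) ++ top)
    ≡⟨ cong (λ H → initLin (H ++ top)) (Listₚ.map-++ (hook a) L (a ∷ [])) ⟩
  initLin ((map (hook a) L ++ hook a a ∷ []) ++ top)
    ≡⟨ cong initLin (Listₚ.++-assoc (map (hook a) L) _ top) ⟩
  initLin (map (hook a) L ++ hook a a ∷ top)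
    ≡⟨ Listₚ.map-++ (map₂ init) (map (hook a) L) _ ⟩
  initLin (map (hook a) L) ++ initLin (hook a a ∷ top)
    ≡⟨ cong₂ _++_ (initLin-hooks (shifted-upTo-bounded m))
                  (cong₂ (λ n r → (+ 2 , init (a ∷ replicate n 1)) ∷ (+ 3 , r) ∷ [])
                         (ℕₚ.n∸n≡0 m) (init-replicate 2 m 1)) ⟩
  map (hook (2 + m)) L ++ (+ 2 , []) ∷ (+ 3 , 2 ∷ replicate m 1) ∷ []
    ∎
  where
  open ≡-Reasoning
  a   = 3 + m
  L   = shifted-upTo m
  top = (+ 3 , 2 ∷ replicate (suc m) 1) ∷ []

module _ (δ : Composition → FormalSum) (isDelta : IsDelta δ) where
  open IsDelta isDelta
  open ≈-Reasoning

  single-admissible : ∀ k → Admissible (2 + k ∷ [])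
  single-admissible k = adm-cons (s≤s (s≤s z≤n)) []

  δ-single-homogeneous : ∀ k → Homogeneous (2 + k) (δ (2 + k ∷ []))
  δ-single-homogeneous k c wc≢ with coeff (δ (2 + k ∷ [])) c ℤ.≟ + 0
  ... | yes c≡0    = c≡0
  ... | no nonzero = ⊥-elim (wc≢ (trans (proj₂ (homogeneous _ (single-admissible k) c nonzero))
                                        (ℕₚ.+-identityʳ (2 + k))))

  δ-empty-twice-++ : ∀ Y Y′ → Y ≈ Y′ → δ [] ++ δ [] ++ Y ≈ basis [] ++ basis [] ++ Y′
  δ-empty-twice-++ Y Y′ Y≈Y′ =
    ++-cong {δ []} {basis []} {δ [] ++ Y} {basis [] ++ Y′} empty
      (++-cong {δ []} {basis []} {Y} {Y′} empty Y≈Y′)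

  δ-single : ∀ k → δ (2 + k ∷ []) ≈ rhs12 (2 + k)
  initLin-δ-single : ∀ k → initLin (δ (2 + k ∷ [])) ≈ initLin (rhs12 (2 + k))

  δ-single k = homogeneous-initLin-injective (δ (2 + k ∷ [])) (rhs12 (2 + k)) (s≤s z≤n)
    (δ-single-homogeneous k) (rhs12-homogeneous k) (initLin-δ-single k)

  initLin-δ-single zero = begin
    initLin (δ (2 ∷ []))
      -- (2)^mid and (2)^fin reduce to ∅ by computation
      ≈⟨ recursion 2 [] (single-admissible 0) ⟩
    δ [] ++ δ [] ++ δ []
      ≈⟨ δ-empty-twice-++ (δ []) (basis []) empty ⟩
    basis [] ++ basis [] ++ basis []
      ≈⟨ ∷-merge (+ 1) (+ 1) [] (basis []) ⟩
    (+ 2 , []) ∷ (+ 1 , []) ∷ []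
      ≈⟨ ∷-merge (+ 2) (+ 1) [] [] ⟩
    (+ 3 , []) ∷ []
      ∎
  initLin-δ-single (suc m) = begin
    initLin (δ (3 + m ∷ []))
      ≈⟨ recursion (3 + m) [] (single-admissible (suc m)) ⟩
    δ [] ++ δ (init (fin (3 + m ∷ []))) ++ δ (fin (3 + m ∷ []))
      ≡⟨ cong (λ d → δ [] ++ δ (init d) ++ δ d) (fin-single m) ⟩
    δ [] ++ δ [] ++ δ (2 + m ∷ [])
      ≈⟨ δ-empty-twice-++ (δ (2 + m ∷ [])) (rhs12 (2 + m)) (δ-single m) ⟩
    basis [] ++ basis [] ++ rhs12 (2 + m)
      ≈⟨ ∷-merge (+ 1) (+ 1) [] (rhs12 (2 + m)) ⟩
    (+ 2 , []) ∷ rhs12 (2 + m)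
      ≈⟨ ++-∷ (map (hook (2 + m)) (shifted-upTo m)) (+ 2 , []) _ ⟨
    map (hook (2 + m)) (shifted-upTo m) ++ (+ 2 , []) ∷ (+ 3 , 2 ∷ replicate m 1) ∷ []
                                               
                                                 ≡⟨ initLin-rhs12 m ⟨
    initLin (rhs12 (3 + m))
      ∎

theorem12 : (δ : Composition → FormalSum) → IsDelta δ →
    (a : ℕ) → 2 ≤ a → δ (a ∷ []) ≈ rhs12 a
theorem12 δ isDelta (suc (suc k)) _ = δ-single δ isDelta k
theorem12 δ isDelta 1 (s≤s ())
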